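{- Let $n\ge 4$, let $\emptyset\ne S\subseteq [n]\times[n]=V(K_n\times K_n)$, and let $x=(i,j)$, $y=(i',j')$ be distinct vertices of $K_n\times K_n$. For $r\in\{i,i'\}$ and $s\in\{j,j'\}$ let $a_r=|L_r\cap S|$ and $b_s=|L^s\cap S|$. (1) If $j=j'$ (so $x,y$ lie in the same horizontal layer), then $\Delta_S(x,y)=a_i+a_{i'}+|\{x,y\}\cap S|$. (2) If $i=i'$ (so $x,y$ lie in the same vertical layer), then $\Delta_S(x,y)=b_j+b_{j'}+|\{x,y\}\cap S|$. (3) If $i\neq i'$ and $j\ne j'$, then with $z_1=(i',j)$ and $z_2=(i,j')$, $$\Delta_S(x,y)=a_i+a_{i'}+b_j+b_{j'}-|\{x,y\}\cap S|-2|\{z_1,z_2\}\cap S|.$$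
   Context: $K_n\times K_n$ is the direct product of two complete graphs: vertex set $[n]\times[n]$ with $[n]=\{1,\dots,n\}$, where $(i,j)$ and $(i',j')$ are adjacent iff $i\ne i'$ and $j\ne j'$. For $i\in[n]$, $L_i=\{(i,j):j\in[n]\}$ (vertical layer) and for $j\in[n]$, $L^j=\{(i,j):i\in[n]\}$ (horizontal layer). With $d$ the shortest-path distance, for $S\subseteq V$ and vertices $x,y,z$: $\Delta_z(x,y)=|d(x,z)-d(y,z)|$ and $\Delta_S(x,y)=\sum_{z\in S}\Delta_z(x,y)$. -}

module Defs where

open import Data.Bool using (Bool; true; false; _∧_; _∨_; not; if_then_else_)
open import Data.Nat using (ℕ; zero; suc; _+_; _*_; ∣_-_∣)
open import Data.Fin using (Fin; _≟_)
open import Data.Product using (_×_; _,_; proj₁; proj₂)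
open import Data.List using (List; map; allFin; filter; length)
open import Data.Bool.ListAction using (any)
open import Data.Nat.ListAction using (sum)
open import Relation.Nullary.Decidable using (⌊_⌋)

Vertex : ℕ → Set
Vertex n = Fin n × Fin n

_==_ : ∀ {n} → Fin n → Fin n → Bool
a == b = ⌊ a ≟ b ⌋

_=V_ : ∀ {n} → Vertex n → Vertex n → Bool
(i , j) =V (i' , j') = (i == i') ∧ (j == j')

adj : ∀ {n} → Vertex n → Vertex n → Bool
adj (i , j) (i' , j') = not (i == i') ∧ not (j == j')

allV : ∀ n → List (Vertex n)
allV n = Data.List.concatMap (λ i → map (λ j → (i , j)) (allFin n)) (allFin n)

walk : ∀ {n} → ℕ → Vertex n → Vertex n → Bool
walk zero    x y = x =V y
walk {n} (suc k) x y = any (λ z → adj x z ∧ walk k z y) (allV n)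

search : ℕ → ℕ → (ℕ → Bool) → ℕ
search zero       k p = k
search (suc fuel) k p = if p k then k else search fuel (suc k) p

-- Shortest-path distance d(x,y): the least k with a walk of length k from x to y.
-- (A shortest walk has fewer than |V| = n*n edges, so searching k ∈ {0,…,n*n}
-- suffices; the fallback value is only reached if y is unreachable from x.)
dist : ∀ {n} → Vertex n → Vertex n → ℕ
dist {n} x y = search (suc (n * n)) 0 (λ k → walk k x y)

VSubset : ℕ → Set
VSubset n = Vertex n → Bool

Δ : ∀ {n} → Vertex n → Vertex n → Vertex n → ℕ
Δ z x y = ∣ dist x z - dist y z ∣

ΔS : ∀ {n} → VSubset n → Vertex n → Vertex n → ℕ
ΔS {n} S x y = sum (map (λ z → Δ z x y) (filter (λ z → S z Data.Bool.≟ true) (allV n)))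

-- |L_r ∩ S|, L_r = {(r,j) : j ∈ [n]} (vertical layer)
vlayerCount : ∀ {n} → VSubset n → Fin n → ℕ
vlayerCount {n} S r = length (filter (λ j → S (r , j) Data.Bool.≟ true) (allFin n))

-- |L^s ∩ S|, L^s = {(i,s) : i ∈ [n]} (horizontal layer)
hlayerCount : ∀ {n} → VSubset n → Fin n → ℕ
hlayerCount {n} S s = length (filter (λ i → S (i , s) Data.Bool.≟ true) (allFin n))

[_] : Bool → ℕ
[ true ]  = 1
[ false ] = 0

-- |{u,v} ∩ S| for distinct vertices u ≠ v
pairCount : ∀ {n} → VSubset n → Vertex n → Vertex n → ℕ
pairCount S u v = [ S u ] + [ S v ]

-- For n ≥ 3 the distance between (i , j) and (k , l) in K_n × K_n only depends on which coordinates
-- agree: it is 0 for equal vertices, 1 if both coordinates differ, and 2 if exactly one agrees, since a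
-- third value in each coordinate gives a common neighbour. So for z = (k , l) the number Δ_z(x , y) is a
-- function of the four Booleans i = k, j = l, i' = k, j' = l, and each of the three formulas holds
-- pointwise in z, as an identity between that function and indicators of the layers L_i, L^j and of
-- single vertices (a finite Boolean check). Summing over z ∈ S turns these indicators into a_r, b_s and
-- the vertex counts.

module Submission where

open import Data.Bool using (Bool; true; false; _∧_; _∨_; not; if_then_else_)
import Data.Bool as Bool
open import Data.Bool.ListAction using (any)
open import Data.Bool.Properties using (T-≡; T-not-≡; ∧-zeroʳ)
open import Data.Fin using (Fin; zero; suc; _≟_)
open import Data.Fin.Properties using (suc-injective)
open import Data.List using (List; []; _∷_; _++_; map; allFin; filter; length; concatMap; tabulate)
open import Data.List.Membership.Propositional using (_∈_; lose)
open import Data.List.Membership.Propositional.Properties using (∈-map⁺; ∈-concat⁺′; ∈-allFin)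
open import Data.List.Properties using (map-++; map-∘; map-tabulate)
open import Data.List.Relation.Unary.Any.Properties using (any⁺)
open import Data.Nat using (ℕ; _+_; _*_; _≤_; zero; suc; z≤n; s≤s; ∣_-_∣)
import Data.Nat.ListAction as List
open import Data.Nat.ListAction.Properties using (sum-++)
open import Data.Nat.Properties using (+-*-semiring; +-identityʳ; *-zeroʳ; n≤1+n; ≤-trans)
open import Data.Product using (_×_; _,_; ∃)
open import Function using (_∘_; Equivalence)
open import Relation.Binary.PropositionalEquality
  using (_≡_; _≢_; refl; sym; trans; cong; cong₂; module ≡-Reasoning)
open import Relation.Nullary using (yes; no; contradiction)
open import Relation.Nullary.Decidable using (⌊⌋-map′; fromWitness; fromWitnessFalse)

open import Defs

open import Algebra.Properties.Semiring.Sum +-*-semiring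
  using (sum; sum-syntax; sum-cong-≗; sum-replicate-zero; ∑-distrib-+; ∑-comm; *-distribˡ-sum)

open Equivalence using (to; from)

any-witness : ∀ {A : Set} (p : A → Bool) {xs : List A} {z : A} → z ∈ xs → p z ≡ true → any p xs ≡ true
any-witness p z∈xs pz = to T-≡ (any⁺ p (lose z∈xs (from T-≡ pz)))

any-false : ∀ {A : Set} (p : A → Bool) (xs : List A) → (∀ z → p z ≡ false) → any p xs ≡ false
any-false p []       p-false = refl
any-false p (x ∷ xs) p-false = cong₂ _∨_ (p-false x) (any-false p xs p-false)

sum-tabulate : ∀ {n} (f : Fin n → ℕ) → List.sum (tabulate f) ≡ sum f
sum-tabulate {zero}  f = refl
sum-tabulate {suc n} f = cong (f zero +_) (sum-tabulate (f ∘ suc))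

sum-map-allFin : ∀ {n} (f : Fin n → ℕ) → List.sum (map f (allFin n)) ≡ sum f
sum-map-allFin f = trans (cong List.sum (map-tabulate (λ k → k) f)) (sum-tabulate f)

sum-map-concatMap : ∀ {A B : Set} (f : B → ℕ) (g : A → List B) (xs : List A)
  → List.sum (map f (concatMap g xs)) ≡ List.sum (map (λ x → List.sum (map f (g x))) xs)
sum-map-concatMap f g []       = refl
sum-map-concatMap f g (x ∷ xs) = begin
  List.sum (map f (g x ++ concatMap g xs))
    ≡⟨ cong List.sum (map-++ f (g x) (concatMap g xs)) ⟩
  List.sum (map f (g x) ++ map f (concatMap g xs))
    ≡⟨ sum-++ (map f (g x)) _ ⟩
  List.sum (map f (g x)) + List.sum (map f (concatMap g xs))
    ≡⟨ cong (List.sum (map f (g x)) +_) (sum-map-concatMap f g xs) ⟩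
  List.sum (map f (g x)) + List.sum (map (λ x → List.sum (map f (g x))) xs) ∎
  where open ≡-Reasoning

sum-map-allV : ∀ {n} (f : Vertex n → ℕ) → List.sum (map f (allV n)) ≡ ∑[ k < n ] ∑[ l < n ] f (k , l)
sum-map-allV {n} f = begin
  List.sum (map f (allV n))
    ≡⟨ sum-map-concatMap f (λ k → map (k ,_) (allFin n)) (allFin n) ⟩
  List.sum (map (λ k → List.sum (map f (map (k ,_) (allFin n)))) (allFin n))
    ≡⟨ sum-map-allFin {n} _ ⟩
  ∑[ k < n ] List.sum (map f (map (k ,_) (allFin n)))
    ≡⟨ sum-cong-≗ {n} (λ k → cong List.sum (sym (map-∘ (allFin n)))) ⟩
  ∑[ k < n ] List.sum (map (λ l → f (k , l)) (allFin n))
    ≡⟨ sum-cong-≗ {n} (λ k → sum-map-allFin (λ l → f (k , l))) ⟩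
  ∑[ k < n ] ∑[ l < n ] f (k , l) ∎
  where open ≡-Reasoning

module _ {A : Set} (P : A → Bool) where

  sum-map-filter : (f : A → ℕ) (xs : List A)
    → List.sum (map f (filter (λ z → P z Bool.≟ true) xs))
      ≡ List.sum (map (λ z → if P z then f z else 0) xs)
  sum-map-filter f []       = refl
  sum-map-filter f (x ∷ xs) with P x
  ... | true  = cong (f x +_) (sum-map-filter f xs)
  ... | false = sum-map-filter f xs

  length-filter≡sum : (xs : List A)
    → length (filter (λ z → P z Bool.≟ true) xs) ≡ List.sum (map (λ z → [ P z ]) xs)
  length-filter≡sum []       = refl
  length-filter≡sum (x ∷ xs) with P x
  ... | true  = cong suc (length-filter≡sum xs)
  ... | false = length-filter≡sum xs

module _ {n : ℕ} where

  ==-refl : (a : Fin n) → a == a ≡ true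
  ==-refl a = to T-≡ (fromWitness refl)

  ≢⇒==-false : {a b : Fin n} → a ≢ b → a == b ≡ false
  ≢⇒==-false a≢b = to T-not-≡ (fromWitnessFalse a≢b)

  =V-refl : (z : Vertex n) → z =V z ≡ true
  =V-refl (a , b) = cong₂ _∧_ (==-refl a) (==-refl b)

  suc-==-suc : (a b : Fin n) → suc a == suc b ≡ a == b
  suc-==-suc a b = ⌊⌋-map′ (cong suc) suc-injective (a ≟ b)

  ==-exclusive : {a b : Fin n} (c : Fin n) → a ≢ b → (a == c) ∧ (b == c) ≡ false
  ==-exclusive {a} {b} c a≢b with a ≟ c | b ≟ c
  ... | yes refl | yes refl = contradiction refl a≢b
  ... | yes _    | no _     = refl
  ... | no _     | _        = refl

  =V⇒≡ : {z w : Vertex n} → z =V w ≡ true → z ≡ w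
  =V⇒≡ {a , b} {c , d} z=w with a ≟ c | b ≟ d
  =V⇒≡ {a , b} {c , d} z=w  | yes refl | yes refl = refl
  =V⇒≡ {a , b} {c , d} ()   | yes _    | no _
  =V⇒≡ {a , b} {c , d} ()   | no _     | _

  ∈-allV : (z : Vertex n) → z ∈ allV n
  ∈-allV (k , l) =
    ∈-concat⁺′ (∈-map⁺ (k ,_) (∈-allFin l)) (∈-map⁺ (λ i → map (i ,_) (allFin n)) (∈-allFin k))

∑-δ : ∀ {n} (i : Fin n) (f : Fin n → ℕ) → ∑[ k < n ] (if i == k then f k else 0) ≡ f i
∑-δ {suc n} zero f = trans (cong (f zero +_) (sum-replicate-zero n)) (+-identityʳ (f zero))
∑-δ (suc i) f =
  trans (sum-cong-≗ (λ k → cong (λ b → if b then f (suc k) else 0) (suc-==-suc i k))) (∑-δ i (f ∘ suc))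

∑-if : ∀ {n} b (f : Fin n → ℕ) → ∑[ k < n ] (if b then f k else 0) ≡ (if b then sum f else 0)
∑-if true  f = refl
∑-if {n} false f = sum-replicate-zero n

∑∑-δ : ∀ {n} (i j : Fin n) (f : Fin n → Fin n → ℕ)
  → ∑[ k < n ] ∑[ l < n ] (if (i == k) ∧ (j == l) then f k l else 0) ≡ f i j
∑∑-δ {n} i j f = begin
  ∑[ k < n ] ∑[ l < n ] (if (i == k) ∧ (j == l) then f k l else 0)
    ≡⟨ sum-cong-≗ {n} (λ k → sum-cong-≗ {n} (λ l → if-∧ (i == k))) ⟩
  ∑[ k < n ] ∑[ l < n ] (if i == k then (if j == l then f k l else 0) else 0)
    ≡⟨ sum-cong-≗ {n} (λ k → ∑-if (i == k) (λ l → if j == l then f k l else 0)) ⟩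
  ∑[ k < n ] (if i == k then ∑[ l < n ] (if j == l then f k l else 0) else 0)
    ≡⟨ sum-cong-≗ {n} (λ k → cong (λ m → if i == k then m else 0) (∑-δ j (f k))) ⟩
  ∑[ k < n ] (if i == k then f k j else 0)
    ≡⟨ ∑-δ i (λ k → f k j) ⟩
  f i j ∎
  where
  open ≡-Reasoning
  if-∧ : ∀ a {b m} → (if a ∧ b then m else 0) ≡ (if a then (if b then m else 0) else 0)
  if-∧ true  = refl
  if-∧ false = refl

-- a is the indicator of i = k and b that of j = l, for vertices (i , j) and (k , l).
layerDist : Bool → Bool → ℕ
layerDist a b = if a ∧ b then 0 else if not a ∧ not b then 1 else 2

module _ {n : ℕ} where

  adj-≢ : {i j k l : Fin n} → i ≢ k → j ≢ l → adj (i , j) (k , l) ≡ true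
  adj-≢ i≢k j≢l = cong₂ (λ u v → not u ∧ not v) (≢⇒==-false i≢k) (≢⇒==-false j≢l)

  walk-1 : (x y : Vertex n) → walk 1 x y ≡ adj x y
  walk-1 x y with adj x y in xy
  ... | true  = any-witness _ (∈-allV y) (cong₂ _∧_ xy (=V-refl y))
  ... | false = any-false _ (allV n) only-y
    where
    only-y : ∀ z → adj x z ∧ (z =V y) ≡ false
    only-y z with z =V y in z=y
    ... | false = ∧-zeroʳ (adj x z)
    ... | true with refl ← =V⇒≡ {z = z} {w = y} z=y = cong (_∧ true) xy

outside-pair : ∀ {m} (u v : Fin (3 + m)) → ∃ λ a → u ≢ a × v ≢ a
outside-pair zero          zero          = suc zero , (λ ()) , (λ ())
outside-pair zero          (suc zero)    = suc (suc zero) , (λ ()) , (λ ())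
outside-pair zero          (suc (suc _)) = suc zero , (λ ()) , (λ ())
outside-pair (suc zero)    zero          = suc (suc zero) , (λ ()) , (λ ())
outside-pair (suc (suc _)) zero          = suc zero , (λ ()) , (λ ())
outside-pair (suc _)       (suc _)       = zero , (λ ()) , (λ ())

walk-2 : ∀ {m} (x y : Vertex (3 + m)) → walk 2 x y ≡ true
walk-2 (i , j) (k , l) =
  let a , i≢a , k≢a = outside-pair i k
      b , j≢b , l≢b = outside-pair j l
  in any-witness (λ z → adj (i , j) z ∧ walk 1 z (k , l)) (∈-allV (a , b))
       (cong₂ _∧_ (adj-≢ i≢a j≢b) (trans (walk-1 (a , b) (k , l)) (adj-≢ (k≢a ∘ sym) (l≢b ∘ sym))))

search-within-three : ∀ {fuel} (p : ℕ → Bool) → 3 ≤ fuel → p 2 ≡ true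
  → search fuel 0 p ≡ (if p 0 then 0 else if p 1 then 1 else 2)
search-within-three p (s≤s (s≤s (s≤s _))) p2 with p 0 | p 1
... | true  | _     = refl
... | false | true  = refl
... | false | false rewrite p2 = refl

dist≡layerDist : ∀ {n} → 3 ≤ n → (i j k l : Fin n) → dist (i , j) (k , l) ≡ layerDist (i == k) (j == l)
dist≡layerDist {n} (s≤s (s≤s (s≤s _))) i j k l =
  trans (search-within-three {suc (n * n)} (λ t → walk t (i , j) (k , l)) (s≤s (s≤s (s≤s z≤n)))
                             (walk-2 (i , j) (k , l)))
        (cong (λ b → if (i == k) ∧ (j == l) then 0 else if b then 1 else 2) (walk-1 (i , j) (k , l)))

sumOver : ∀ {n} → VSubset n → (Vertex n → ℕ) → ℕ
sumOver {n} S w = ∑[ k < n ] ∑[ l < n ] (if S (k , l) then w (k , l) else 0)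

syntax sumOver S (λ z → w) = ∑[ z ∈ S ] w

vlayerIndicator : ∀ {n} → Fin n → Vertex n → ℕ
vlayerIndicator i (k , _) = [ i == k ]

hlayerIndicator : ∀ {n} → Fin n → Vertex n → ℕ
hlayerIndicator j (_ , l) = [ j == l ]

pairIndicator : ∀ {n} → Vertex n → Vertex n → Vertex n → ℕ
pairIndicator x y z = [ x =V z ] + [ y =V z ]

if-[]-swap : ∀ s b → (if s then [ b ] else 0) ≡ (if b then [ s ] else 0)
if-[]-swap true  true  = refl
if-[]-swap true  false = refl
if-[]-swap false true  = refl
if-[]-swap false false = refl

module _ {n : ℕ} (S : VSubset n) where

  sumOver-cong : {v w : Vertex n → ℕ} → (∀ z → v z ≡ w z) → ∑[ z ∈ S ] v z ≡ ∑[ z ∈ S ] w z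
  sumOver-cong v≗w =
    sum-cong-≗ {n} (λ k → sum-cong-≗ {n} (λ l → cong (λ m → if S (k , l) then m else 0) (v≗w (k , l))))

  sumOver-+ : (v w : Vertex n → ℕ) → ∑[ z ∈ S ] (v z + w z) ≡ ∑[ z ∈ S ] v z + ∑[ z ∈ S ] w z
  sumOver-+ v w =
    trans (sum-cong-≗ {n} (λ k → trans (sum-cong-≗ {n} (λ l → if-+ (S (k , l)))) (∑-distrib-+ {n} _ _)))
          (∑-distrib-+ {n} _ _)
    where
    if-+ : ∀ s {a b} → (if s then a + b else 0) ≡ (if s then a else 0) + (if s then b else 0)
    if-+ true  = refl
    if-+ false = refl

  sumOver-* : (c : ℕ) (w : Vertex n → ℕ) → ∑[ z ∈ S ] (c * w z) ≡ c * ∑[ z ∈ S ] w z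
  sumOver-* c w = sym (trans (*-distribˡ-sum {n} c _) (sum-cong-≗ {n} (λ k → trans (*-distribˡ-sum {n} c _)
                    (sum-cong-≗ {n} (λ l → if-* (S (k , l)))))))
    where
    if-* : ∀ s {a} → c * (if s then a else 0) ≡ (if s then c * a else 0)
    if-* true  = refl
    if-* false = *-zeroʳ c

  ΔS≡sumOver : (x y : Vertex n) → ΔS S x y ≡ ∑[ z ∈ S ] Δ z x y
  ΔS≡sumOver x y =
    trans (sum-map-filter S (λ z → Δ z x y) (allV n)) (sum-map-allV (λ z → if S z then Δ z x y else 0))

  indicator≡sumOver : (x : Vertex n) → [ S x ] ≡ ∑[ z ∈ S ] [ x =V z ]
  indicator≡sumOver (i , j) =
    sym (trans (sum-cong-≗ {n} (λ k → sum-cong-≗ {n} (λ l → if-[]-swap (S (k , l)) _)))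
               (∑∑-δ i j (λ k l → [ S (k , l) ])))

  pairCount≡sumOver : (x y : Vertex n) → pairCount S x y ≡ sumOver S (pairIndicator x y)
  pairCount≡sumOver x y =
    trans (cong₂ _+_ (indicator≡sumOver x) (indicator≡sumOver y))
          (sym (sumOver-+ (λ z → [ x =V z ]) (λ z → [ y =V z ])))

  vlayerCount≡sumOver : (i : Fin n) → vlayerCount S i ≡ sumOver S (vlayerIndicator i)
  vlayerCount≡sumOver i = begin
    vlayerCount S i
      ≡⟨ trans (length-filter≡sum (λ l → S (i , l)) (allFin n)) (sum-map-allFin (λ l → [ S (i , l) ])) ⟩
    ∑[ l < n ] [ S (i , l) ]
      ≡⟨ sum-cong-≗ {n} (λ l → ∑-δ i (λ k → [ S (k , l) ])) ⟨
    ∑[ l < n ] ∑[ k < n ] (if i == k then [ S (k , l) ] else 0)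
      ≡⟨ ∑-comm (λ k l → if i == k then [ S (k , l) ] else 0) ⟨
    ∑[ k < n ] ∑[ l < n ] (if i == k then [ S (k , l) ] else 0)
      ≡⟨ sum-cong-≗ {n} (λ k → sum-cong-≗ {n} (λ l → if-[]-swap (S (k , l)) (i == k))) ⟨
    sumOver S (vlayerIndicator i) ∎
    where open ≡-Reasoning

  hlayerCount≡sumOver : (j : Fin n) → hlayerCount S j ≡ sumOver S (hlayerIndicator j)
  hlayerCount≡sumOver j = begin
    hlayerCount S j
      ≡⟨ trans (length-filter≡sum (λ k → S (k , j)) (allFin n)) (sum-map-allFin (λ k → [ S (k , j) ])) ⟩
    ∑[ k < n ] [ S (k , j) ]
      ≡⟨ sum-cong-≗ {n} (λ k → ∑-δ j (λ l → [ S (k , l) ])) ⟨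
    ∑[ k < n ] ∑[ l < n ] (if j == l then [ S (k , l) ] else 0)
      ≡⟨ sum-cong-≗ {n} (λ k → sum-cong-≗ {n} (λ l → if-[]-swap (S (k , l)) (j == l))) ⟨
    sumOver S (hlayerIndicator j) ∎
    where open ≡-Reasoning

layerDist-gap-horizontal : ∀ a b c → a ∧ c ≡ false
  → ∣ layerDist a b - layerDist c b ∣ ≡ [ a ] + [ c ] + ([ a ∧ b ] + [ c ∧ b ])
layerDist-gap-horizontal true  _     true  ()
layerDist-gap-horizontal true  true  false _ = refl
layerDist-gap-horizontal true  false false _ = refl
layerDist-gap-horizontal false true  true  _ = refl
layerDist-gap-horizontal false false true  _ = refl
layerDist-gap-horizontal false true  false _ = refl
layerDist-gap-horizontal false false false _ = refl

layerDist-gap-vertical : ∀ a b d → b ∧ d ≡ false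
  → ∣ layerDist a b - layerDist a d ∣ ≡ [ b ] + [ d ] + ([ a ∧ b ] + [ a ∧ d ])
layerDist-gap-vertical _     true  true  ()
layerDist-gap-vertical true  true  false _ = refl
layerDist-gap-vertical true  false true  _ = refl
layerDist-gap-vertical true  false false _ = refl
layerDist-gap-vertical false true  false _ = refl
layerDist-gap-vertical false false true  _ = refl
layerDist-gap-vertical false false false _ = refl

layerDist-gap-diagonal : ∀ a b c d → a ∧ c ≡ false → b ∧ d ≡ false
  → ∣ layerDist a b - layerDist c d ∣ + ([ a ∧ b ] + [ c ∧ d ]) + 2 * ([ c ∧ b ] + [ a ∧ d ])
    ≡ [ a ] + [ c ] + [ b ] + [ d ]
layerDist-gap-diagonal true  _     true  _     () _
layerDist-gap-diagonal _     true  _     true  _  ()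
layerDist-gap-diagonal true  true  false false _ _ = refl
layerDist-gap-diagonal true  false false true  _ _ = refl
layerDist-gap-diagonal true  false false false _ _ = refl
layerDist-gap-diagonal false true  true  false _ _ = refl
layerDist-gap-diagonal false false true  true  _ _ = refl
layerDist-gap-diagonal false false true  false _ _ = refl
layerDist-gap-diagonal false true  false false _ _ = refl
layerDist-gap-diagonal false false false true  _ _ = refl
layerDist-gap-diagonal false false false false _ _ = refl

module _ {n : ℕ} (3≤n : 3 ≤ n) (S : VSubset n) where

  Δ≡layerDist-gap : (i j i' j' k l : Fin n)
    → Δ (k , l) (i , j) (i' , j') ≡ ∣ layerDist (i == k) (j == l) - layerDist (i' == k) (j' == l) ∣
  Δ≡layerDist-gap i j i' j' k l = cong₂ ∣_-_∣ (dist≡layerDist 3≤n i j k l) (dist≡layerDist 3≤n i' j' k l)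

  ΔS-horizontal : {i i' : Fin n} (j : Fin n) → i ≢ i'
    → ΔS S (i , j) (i' , j) ≡ vlayerCount S i + vlayerCount S i' + pairCount S (i , j) (i' , j)
  ΔS-horizontal {i} {i'} j i≢i' = begin
    ΔS S (i , j) (i' , j)
      ≡⟨ ΔS≡sumOver S (i , j) (i' , j) ⟩
    ∑[ z ∈ S ] Δ z (i , j) (i' , j)
      ≡⟨ sumOver-cong S (λ (k , l) → trans (Δ≡layerDist-gap i j i' j k l)
           (layerDist-gap-horizontal (i == k) (j == l) (i' == k) (==-exclusive k i≢i'))) ⟩
    ∑[ z ∈ S ] (vlayerIndicator i z + vlayerIndicator i' z + pairIndicator (i , j) (i' , j) z)
      ≡⟨ trans (sumOver-+ S _ (pairIndicator (i , j) (i' , j)))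
               (cong₂ _+_ (sumOver-+ S (vlayerIndicator i) (vlayerIndicator i')) refl) ⟩
    sumOver S (vlayerIndicator i) + sumOver S (vlayerIndicator i') + sumOver S (pairIndicator (i , j) (i' , j))
      ≡⟨ cong₂ _+_ (cong₂ _+_ (vlayerCount≡sumOver S i) (vlayerCount≡sumOver S i')) (pairCount≡sumOver S _ _) ⟨
    vlayerCount S i + vlayerCount S i' + pairCount S (i , j) (i' , j) ∎
    where open ≡-Reasoning

  ΔS-vertical : (i : Fin n) {j j' : Fin n} → j ≢ j'
    → ΔS S (i , j) (i , j') ≡ hlayerCount S j + hlayerCount S j' + pairCount S (i , j) (i , j')
  ΔS-vertical i {j} {j'} j≢j' = begin
    ΔS S (i , j) (i , j')
      ≡⟨ ΔS≡sumOver S (i , j) (i , j') ⟩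
    ∑[ z ∈ S ] Δ z (i , j) (i , j')
      ≡⟨ sumOver-cong S (λ (k , l) → trans (Δ≡layerDist-gap i j i j' k l)
           (layerDist-gap-vertical (i == k) (j == l) (j' == l) (==-exclusive l j≢j'))) ⟩
    ∑[ z ∈ S ] (hlayerIndicator j z + hlayerIndicator j' z + pairIndicator (i , j) (i , j') z)
      ≡⟨ trans (sumOver-+ S _ (pairIndicator (i , j) (i , j')))
               (cong₂ _+_ (sumOver-+ S (hlayerIndicator j) (hlayerIndicator j')) refl) ⟩
    sumOver S (hlayerIndicator j) + sumOver S (hlayerIndicator j') + sumOver S (pairIndicator (i , j) (i , j'))
      ≡⟨ cong₂ _+_ (cong₂ _+_ (hlayerCount≡sumOver S j) (hlayerCount≡sumOver S j')) (pairCount≡sumOver S _ _) ⟨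
    hlayerCount S j + hlayerCount S j' + pairCount S (i , j) (i , j') ∎
    where open ≡-Reasoning

  ΔS-diagonal : {i j i' j' : Fin n} → i ≢ i' → j ≢ j'
    → ΔS S (i , j) (i' , j') + pairCount S (i , j) (i' , j') + 2 * pairCount S (i' , j) (i , j')
      ≡ vlayerCount S i + vlayerCount S i' + hlayerCount S j + hlayerCount S j'
  ΔS-diagonal {i} {j} {i'} {j'} i≢i' j≢j' = begin
    ΔS S x y + pairCount S x y + 2 * pairCount S z₁ z₂
      ≡⟨ cong₂ _+_ (cong₂ _+_ (ΔS≡sumOver S x y) (pairCount≡sumOver S x y))
                   (cong (2 *_) (pairCount≡sumOver S z₁ z₂)) ⟩
    ∑[ z ∈ S ] Δ z x y + sumOver S (pairIndicator x y) + 2 * sumOver S (pairIndicator z₁ z₂)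
      ≡⟨ trans (sumOver-+ S _ (λ z → 2 * pairIndicator z₁ z₂ z))
               (cong₂ _+_ (sumOver-+ S (λ z → Δ z x y) (pairIndicator x y))
                          (sumOver-* S 2 (pairIndicator z₁ z₂))) ⟨
    ∑[ z ∈ S ] (Δ z x y + pairIndicator x y z + 2 * pairIndicator z₁ z₂ z)
      ≡⟨ sumOver-cong S (λ (k , l) →
           trans (cong (λ m → m + pairIndicator x y (k , l) + 2 * pairIndicator z₁ z₂ (k , l))
                       (Δ≡layerDist-gap i j i' j' k l))
                 (layerDist-gap-diagonal (i == k) (j == l) (i' == k) (j' == l)
                                         (==-exclusive k i≢i') (==-exclusive l j≢j'))) ⟩
    ∑[ z ∈ S ] (vlayerIndicator i z + vlayerIndicator i' z + hlayerIndicator j z + hlayerIndicator j' z)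
      ≡⟨ trans (sumOver-+ S _ (hlayerIndicator j'))
           (cong₂ _+_ (trans (sumOver-+ S _ (hlayerIndicator j))
                             (cong₂ _+_ (sumOver-+ S (vlayerIndicator i) (vlayerIndicator i')) refl)) refl) ⟩
    sumOver S (vlayerIndicator i) + sumOver S (vlayerIndicator i')
      + sumOver S (hlayerIndicator j) + sumOver S (hlayerIndicator j')
      ≡⟨ cong₂ _+_ (cong₂ _+_ (cong₂ _+_ (vlayerCount≡sumOver S i) (vlayerCount≡sumOver S i'))
                              (hlayerCount≡sumOver S j)) (hlayerCount≡sumOver S j') ⟨
    vlayerCount S i + vlayerCount S i' + hlayerCount S j + hlayerCount S j' ∎
    where
    open ≡-Reasoning
    x y z₁ z₂ : Vertex n
    x = i , j
    y = i' , j'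
    z₁ = i' , j
    z₂ = i , j'

mainTheorem2 : (n : ℕ) → 4 ≤ n → (S : VSubset n) → ∃ (λ (z : Vertex n) → S z ≡ true)
    → (i j i' j' : Fin n) → (i , j) ≢ (i' , j')
    → ((j ≡ j' → ΔS S (i , j) (i' , j')
          ≡ vlayerCount S i + vlayerCount S i' + pairCount S (i , j) (i' , j'))
      × (i ≡ i' → ΔS S (i , j) (i' , j')
          ≡ hlayerCount S j + hlayerCount S j' + pairCount S (i , j) (i' , j'))
      × (i ≢ i' → j ≢ j' → ΔS S (i , j) (i' , j') + pairCount S (i , j) (i' , j')
            + 2 * pairCount S (i' , j) (i , j')
          ≡ vlayerCount S i + vlayerCount S i' + hlayerCount S j + hlayerCount S j'))
mainTheorem2 n 4≤n S _ i j i' j' x≢y =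
  (λ { refl → ΔS-horizontal 3≤n S j (λ { refl → x≢y refl }) }) ,
  (λ { refl → ΔS-vertical 3≤n S i (λ { refl → x≢y refl }) }) ,
  ΔS-diagonal 3≤n S
  where
  3≤n : 3 ≤ n
  3≤n = ≤-trans (n≤1+n 3) 4≤n
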